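{- Let $T$ be a tree of order $n\ge2$ and let $r$ be a positive integer. Let $c:E\to\mathbb{R}$ be a proper edge-colouring of a graph $G=(V,E)$, and suppose $m_e(G,i)=\dim(W^i_{G,c})$ for $r-1\le i\le r$. If \[m_e(G,r)+(n-1)m_e(G,r-1)+d^G_{r-1}+\sum_{t=1}^{r-1}d^G_{r-1-t}\Big(1+t\sum_{i=t+1}^{\Delta(T)}d^T_i+\sum_{i=2}^{t}(i-1)d^T_i\Big)\] equals \[\dim(W^r_{G,c})+(n-1)\dim(W^{r-1}_{G,c})+d^G_{r-1}+\sum_{t=0}^{r-2}d^G_t\Big(1+\sum_{i=2}^{\Delta(T)}d^T_i\Big),\] then either $\delta(G)\ge r-2$ or $T$ is a path.
   Context: All graphs are finite and simple. For a graph $G$ and integer $r\ge0$, the $r$-bond bootstrap percolation process on $G$ starts from a set $S\subseteq E(G)$ of infected edges; at each step a healthy edge becomes infected if at least one of its endpoints is incident with at least $r$ infected edges, and infected edges stay infected. $S$ is $r$-percolating if it eventually infects all of $E(G)$; $m_e(G,r)$ is the minimum size of an $r$-percolating set. For $G=(V,E)$, integer $r\ge0$ and proper edge-colouring $c:E\to\mathbb{R}$, $W^r_{G,c}$ is the real vector space of all vectors $(p_v)_{v\in V}$ with entries in $\mathbb{R}[x]$ such that $\deg(p_v)\le\min\{r,\deg(v)\}-1$ for all $v$ (the zero polynomial has degree $-1$) and $p_u(c(uv))=p_v(c(uv))$ for every edge $uv\in E$. For a graph $F$, $d^F_t$ is the number of vertices of $F$ of degree $t$; $\delta,\Delta$ are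 minimum and maximum degree. (The two displayed expressions are, respectively, an upper bound and a lower bound for $m_e(G\square T,r)$, where $\square$ is the Cartesian product.) -}

module Defs where

open import Level using (0ℓ)
open import Data.Bool using (Bool; true; false; _∧_; _∨_; if_then_else_)
open import Data.Nat using (ℕ; zero; suc; _+_; _∸_; _≤_; _<_; _≤ᵇ_; _⊓_; _⊔_)
open import Data.Nat.Properties using (_≟_)
open import Data.Fin using (Fin; toℕ; inject₁; fromℕ) renaming (zero to fzero; suc to fsuc)
open import Data.List using (List; []; _∷_; map; foldr; allFin; upTo)
open import Data.Nat.ListAction using (sum)
open import Data.Vec using (Vec; []; _∷_; zipWith; replicate)
open import Data.Product using (Σ; ∃; _×_; _,_)
open import Data.Empty using (⊥)
open import Relation.Nullary using (¬_)
open import Relation.Nullary.Decidable using (⌊_⌋)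
open import Relation.Binary.PropositionalEquality using (_≡_)
open import Function.Definitions using (Injective; Bijective)
open import Algebra.Bundles using (CommutativeRing)

record Graph : Set where
  field
    n      : ℕ
    adj    : Fin n → Fin n → Bool
    sym    : ∀ i j → adj i j ≡ adj j i
    irrefl : ∀ i → adj i i ≡ false

open Graph public

countTrue : List Bool → ℕ
countTrue []          = 0
countTrue (true ∷ bs)  = suc (countTrue bs)
countTrue (false ∷ bs) = countTrue bs

deg : (G : Graph) → Fin (n G) → ℕ
deg G v = countTrue (map (adj G v) (allFin (n G)))

dcount : (G : Graph) → ℕ → ℕ
dcount G t = countTrue (map (λ v → ⌊ deg G v ≟ t ⌋) (allFin (n G)))

maxDeg : Graph → ℕ
maxDeg G = foldr _⊔_ 0 (map (deg G) (allFin (n G)))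

MinDegAtLeast : Graph → ℕ → Set
MinDegAtLeast G k = ∀ v → k ≤ deg G v

-- Σ_{i=a}^{b} f i  (empty, i.e. 0, when b < a)
sumFromTo : ℕ → ℕ → (ℕ → ℕ) → ℕ
sumFromTo a b f = sum (map (λ i → f (a + i)) (upTo (suc b ∸ a)))

data Walk (G : Graph) : Fin (n G) → Fin (n G) → Set where
  here : ∀ {u} → Walk G u u
  step : ∀ {u w v} → adj G u w ≡ true → Walk G w v → Walk G u v

Connected : Graph → Set
Connected G = ∀ u v → Walk G u v

HasCycle : Graph → Set
HasCycle G = Σ ℕ λ k → Σ (Fin (suc (suc (suc k))) → Fin (n G)) λ f →
  Injective _≡_ _≡_ f
  × (∀ (i : Fin (suc (suc k))) → adj G (f (inject₁ i)) (f (fsuc i)) ≡ true)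
  × adj G (f (fromℕ (suc (suc k)))) (f fzero) ≡ true

IsTree : Graph → Set
IsTree G = Connected G × ¬ HasCycle G

pathAdj : (m : ℕ) → Fin m → Fin m → Bool
pathAdj m i j = ⌊ suc (toℕ i) ≟ toℕ j ⌋ ∨ ⌊ suc (toℕ j) ≟ toℕ i ⌋

Isomorphic : Graph → Graph → Set
Isomorphic G H = Σ (Fin (n G) → Fin (n H)) λ f →
  Bijective _≡_ _≡_ f × (∀ i j → adj G i j ≡ adj H (f i) (f j))

IsPath : Graph → Set
IsPath T = Σ (∀ i j → pathAdj (n T) i j ≡ pathAdj (n T) j i) λ s →
           Σ (∀ i → pathAdj (n T) i i ≡ false) λ ir →
           Isomorphic T (record { n = n T ; adj = pathAdj (n T) ; sym = s ; irrefl = ir })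

-- a set of edges, given as a symmetric 0/1 matrix contained in adj
EdgeSet : Graph → Set
EdgeSet G = Fin (n G) → Fin (n G) → Bool

IsEdgeSubset : (G : Graph) → EdgeSet G → Set
IsEdgeSubset G S = (∀ u v → S u v ≡ S v u) × (∀ u v → S u v ≡ true → adj G u v ≡ true)

infDeg : (G : Graph) → EdgeSet G → Fin (n G) → ℕ
infDeg G S v = countTrue (map (λ j → adj G v j ∧ S v j) (allFin (n G)))

bstep : (G : Graph) → ℕ → EdgeSet G → EdgeSet G
bstep G r S u v = S u v ∨ (adj G u v ∧ ((r ≤ᵇ infDeg G S u) ∨ (r ≤ᵇ infDeg G S v)))

iter : (G : Graph) → ℕ → ℕ → EdgeSet G → EdgeSet G
iter G r zero    S = S
iter G r (suc k) S = bstep G r (iter G r k S)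

Percolating : (G : Graph) → ℕ → EdgeSet G → Set
Percolating G r S = Σ ℕ λ k → ∀ u v → adj G u v ≡ true → iter G r k S u v ≡ true

edgeCount : (G : Graph) → EdgeSet G → ℕ
edgeCount G S = countTrue (Data.List.concatMap (λ u → map (λ v → ⌊ suc (toℕ u) Data.Nat.≤? toℕ v ⌋ ∧ S u v) (allFin (n G))) (allFin (n G)))
  where import Data.List ; import Data.Nat

IsMe : (G : Graph) → ℕ → ℕ → Set
IsMe G r k =
  (Σ (EdgeSet G) λ S → IsEdgeSubset G S × Percolating G r S × edgeCount G S ≡ k)
  × (∀ S → IsEdgeSubset G S → Percolating G r S → k ≤ edgeCount G S)

record Field : Set₁ where
  field
    ring  : CommutativeRing 0ℓ 0ℓ
  open CommutativeRing ring public using (Carrier; _≈_; 0#; 1#) renaming (_+_ to _+K_; _*_ to _*K_)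
  field
    0≉1     : ¬ (0# ≈ 1#)
    inverse : ∀ x → ¬ (x ≈ 0#) → Σ Carrier λ y → x *K y ≈ 1#

module _ (K : Field) where
  open Field K

  -- proper edge colouring (values on non-edges are irrelevant)
  IsProperColouring : (G : Graph) → (Fin (n G) → Fin (n G) → Carrier) → Set
  IsProperColouring G c =
    (∀ u v → adj G u v ≡ true → c u v ≈ c v u)
    × (∀ u v w → adj G u v ≡ true → adj G u w ≡ true → ¬ (v ≡ w) → ¬ (c u v ≈ c u w))

  -- polynomial with coefficient list a₀ ∷ a₁ ∷ … evaluated at x
  evalPoly : ∀ {k} → Vec Carrier k → Carrier → Carrier
  evalPoly []       x = 0#
  evalPoly (a ∷ as) x = a +K (x *K evalPoly as x)

  -- ambient space: p_v has degree ≤ min{r, deg v} - 1, i.e. min{r,deg v} coefficients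
  Amb : (G : Graph) → ℕ → Set
  Amb G r = (v : Fin (n G)) → Vec Carrier (r ⊓ deg G v)

  EqA : ∀ G r → Amb G r → Amb G r → Set
  EqA G r p q = ∀ v → Data.Vec.Relation.Binary.Pointwise.Inductive.Pointwise _≈_ (p v) (q v)
    where import Data.Vec.Relation.Binary.Pointwise.Inductive

  zeroA : ∀ G r → Amb G r
  zeroA G r v = replicate _ 0#

  addA : ∀ G r → Amb G r → Amb G r → Amb G r
  addA G r p q v = zipWith _+K_ (p v) (q v)

  scaleA : ∀ G r → Carrier → Amb G r → Amb G r
  scaleA G r a p v = Data.Vec.map (a *K_) (p v)
    where import Data.Vec

  lincomb : ∀ G r → (k : ℕ) → (Fin k → Carrier) → (Fin k → Amb G r) → Amb G r
  lincomb G r zero    a b = zeroA G r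
  lincomb G r (suc k) a b = addA G r (scaleA G r (a fzero) (b fzero)) (lincomb G r k (λ i → a (fsuc i)) (λ i → b (fsuc i)))

  InW : (G : Graph) → (r : ℕ) → (Fin (n G) → Fin (n G) → Carrier) → Amb G r → Set
  InW G r c p = ∀ u v → adj G u v ≡ true → evalPoly (p u) (c u v) ≈ evalPoly (p v) (c u v)

  IsDimW : (G : Graph) → ℕ → (Fin (n G) → Fin (n G) → Carrier) → ℕ → Set
  IsDimW G r c k = Σ (Fin k → Amb G r) λ b →
    (∀ i → InW G r c (b i))
    × (∀ a → EqA G r (lincomb G r k a b) (zeroA G r) → ∀ i → a i ≈ 0#)
    × (∀ p → InW G r c p → Σ (Fin k → Carrier) λ a → EqA G r p (lincomb G r k a b))

sumBelow : ℕ → (ℕ → ℕ) → ℕ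
sumBelow m f = sum (map f (upTo m))

-- Once m_e = dim W is used, the hypothesis is an identity between two degree sums.
-- Reindexing the right-hand sum by t ↦ r − 1 − t, it compares termwise with the left:
-- the factor 1 + Σ_{i≥2} d^T_i is at most 1 + Σ_{i≥2} min(i − 1, t) d^T_i for t ≥ 1, strictly
-- when t ≥ 2 and T has a vertex of degree ≥ 3. A vertex of G of degree s < r − 2 makes the
-- term t = r − 1 − s ≥ 2 present, so either δ(G) ≥ r − 2 or Δ(T) ≤ 2. A tree of maximum
-- degree at most 2 is a path: extend a path at both ends until every neighbour of an end lies
-- on it; degrees ≤ 2 and acyclicity then make its vertex set closed under adjacency, with
-- exactly the consecutive pairs adjacent.
module Submission where

open import Defs hiding (sym)
open import Data.Bool using (Bool; true; false; _∨_)
open import Data.Bool.Properties using (∨-comm) renaming (_≟_ to _≟ᵇ_)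
open import Data.Nat
open import Data.Nat.Properties
open import Data.Fin using (Fin; toℕ; fromℕ<) renaming (zero to fzero; suc to fsuc)
open import Data.Fin.Properties
  using ( all?; any?; ¬∀⟶∃¬; injective⇒≤; toℕ-injective; toℕ<n
        ; toℕ-fromℕ<; toℕ-fromℕ; toℕ-inject₁; fromℕ<-injective)
  renaming (_≟_ to _≟ᶠ_)
open import Data.List using (_∷_; map; foldr; allFin; tabulate)
open import Data.List.Properties using (map-applyUpTo; map-upTo; map-tabulate)
open import Data.List.Membership.Propositional using (_∈_)
open import Data.List.Membership.Propositional.Properties using (∈-allFin)
import Data.List.Relation.Unary.Any as Any
open import Data.Nat.ListAction using (sum)
open import Data.Product using (Σ; ∃; _×_; _,_; proj₁; proj₂)
open import Data.Sum using (_⊎_; inj₁; inj₂; swap)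
open import Data.Empty using (⊥; ⊥-elim)
open import Function using (_∘_; id)
open import Relation.Nullary using (¬_; Dec; yes; no; contradiction)
open import Relation.Nullary.Decidable using (⌊_⌋; _×-dec_; ¬?)
open import Relation.Binary.PropositionalEquality

sumBelow-suc : ∀ m (f : ℕ → ℕ) → sumBelow (suc m) f ≡ f 0 + sumBelow m (f ∘ suc)
sumBelow-suc m f =
  cong (λ xs → f 0 + sum xs) (trans (map-applyUpTo suc f m) (sym (map-upTo (f ∘ suc) m)))

sumBelow-cong : ∀ m {f g : ℕ → ℕ} → (∀ {i} → i < m → f i ≡ g i) → sumBelow m f ≡ sumBelow m g
sumBelow-cong zero    f≗g = refl
sumBelow-cong (suc m) {f} {g} f≗g = begin
  sumBelow (suc m) f              ≡⟨ sumBelow-suc m f ⟩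
  f 0 + sumBelow m (f ∘ suc)      ≡⟨ cong₂ _+_ (f≗g z<s) (sumBelow-cong m (f≗g ∘ s<s)) ⟩
  g 0 + sumBelow m (g ∘ suc)      ≡⟨ sumBelow-suc m g ⟨
  sumBelow (suc m) g              ∎
  where open ≡-Reasoning

sumBelow-mono-≤ : ∀ m {f g : ℕ → ℕ} → (∀ {i} → i < m → f i ≤ g i) → sumBelow m f ≤ sumBelow m g
sumBelow-mono-≤ zero    f≤g = z≤n
sumBelow-mono-≤ (suc m) {f} {g} f≤g = begin
  sumBelow (suc m) f              ≡⟨ sumBelow-suc m f ⟩
  f 0 + sumBelow m (f ∘ suc)      ≤⟨ +-mono-≤ (f≤g z<s) (sumBelow-mono-≤ m (f≤g ∘ s<s)) ⟩
  g 0 + sumBelow m (g ∘ suc)      ≡⟨ sumBelow-suc m g ⟨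
  sumBelow (suc m) g              ∎
  where open ≤-Reasoning

sumBelow-mono-< : ∀ m {f g : ℕ → ℕ} → (∀ {i} → i < m → f i ≤ g i) →
                  ∀ {j} → j < m → f j < g j → sumBelow m f < sumBelow m g
sumBelow-mono-< (suc m) {f} {g} f≤g {j} j<m fj<gj = begin-strict
  sumBelow (suc m) f              ≡⟨ sumBelow-suc m f ⟩
  f 0 + sumBelow m (f ∘ suc)      <⟨ head-or-tail j j<m fj<gj ⟩
  g 0 + sumBelow m (g ∘ suc)      ≡⟨ sumBelow-suc m g ⟨
  sumBelow (suc m) g              ∎
  where
  open ≤-Reasoning
  head-or-tail : ∀ j → j < suc m → f j < g j → f 0 + sumBelow m (f ∘ suc) < g 0 + sumBelow m (g ∘ suc)
  head-or-tail zero    _         f0<g0 = +-mono-<-≤ f0<g0 (sumBelow-mono-≤ m (f≤g ∘ s<s))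
  head-or-tail (suc j) (s<s j<m) fj<gj = +-mono-≤-< (f≤g z<s) (sumBelow-mono-< m (f≤g ∘ s<s) j<m fj<gj)

sumBelow-term : ∀ m (f : ℕ → ℕ) {j} → j < m → f j ≤ sumBelow m f
sumBelow-term (suc m) f {zero}  _         = ≤-trans (m≤m+n (f 0) _) (≤-reflexive (sym (sumBelow-suc m f)))
sumBelow-term (suc m) f {suc j} (s<s j<m) =
  ≤-trans (sumBelow-term m (f ∘ suc) j<m) (≤-trans (m≤n+m _ (f 0)) (≤-reflexive (sym (sumBelow-suc m f))))

sumBelow-+ : ∀ m k (f : ℕ → ℕ) → sumBelow (m + k) f ≡ sumBelow m f + sumBelow k (λ i → f (m + i))
sumBelow-+ zero    k f = refl
sumBelow-+ (suc m) k f = begin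
  sumBelow (suc m + k) f                        ≡⟨ sumBelow-suc (m + k) f ⟩
  f 0 + sumBelow (m + k) (f ∘ suc)              ≡⟨ cong (f 0 +_) (sumBelow-+ m k (f ∘ suc)) ⟩
  f 0 + (sumBelow m (f ∘ suc) + tail)           ≡⟨ +-assoc (f 0) _ _ ⟨
  f 0 + sumBelow m (f ∘ suc) + tail             ≡⟨ cong (_+ tail) (sumBelow-suc m f) ⟨
  sumBelow (suc m) f + tail                     ∎
  where
  open ≡-Reasoning
  tail : ℕ
  tail = sumBelow k (λ i → f (suc m + i))

sumBelow-snoc : ∀ m (f : ℕ → ℕ) → sumBelow (suc m) f ≡ sumBelow m f + f m
sumBelow-snoc m f = begin
  sumBelow (suc m) f                        ≡⟨ cong (λ k → sumBelow k f) (+-comm 1 m) ⟩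
  sumBelow (m + 1) f                        ≡⟨ sumBelow-+ m 1 f ⟩
  sumBelow m f + (f (m + 0) + 0)            ≡⟨ cong (sumBelow m f +_) (trans (+-identityʳ _) (cong f (+-identityʳ m))) ⟩
  sumBelow m f + f m                        ∎
  where open ≡-Reasoning

sumBelow-reverse : ∀ m (f : ℕ → ℕ) → sumBelow m f ≡ sumBelow m (λ i → f (m ∸ suc i))
sumBelow-reverse zero    f = refl
sumBelow-reverse (suc m) f = begin
  sumBelow (suc m) f                               ≡⟨ sumBelow-suc m f ⟩
  f 0 + sumBelow m (f ∘ suc)                       ≡⟨ cong (f 0 +_) (sumBelow-reverse m (f ∘ suc)) ⟩
  f 0 + sumBelow m (λ i → f (suc (m ∸ suc i)))
    ≡⟨ cong (f 0 +_) (sumBelow-cong m (cong f ∘ sym ∘ +-∸-assoc 1)) ⟩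
  f 0 + sumBelow m (λ i → f (m ∸ i))               ≡⟨ +-comm (f 0) _ ⟩
  sumBelow m (λ i → f (m ∸ i)) + f 0
    ≡⟨ cong (λ k → sumBelow m (λ i → f (m ∸ i)) + f k) (n∸n≡0 m) ⟨
  sumBelow m (λ i → f (m ∸ i)) + f (m ∸ m)         ≡⟨ sumBelow-snoc m (λ i → f (m ∸ i)) ⟨
  sumBelow (suc m) (λ i → f (suc m ∸ suc i))       ∎
  where open ≡-Reasoning

sumBelow-monoˡ-≤ : ∀ {m m'} (f : ℕ → ℕ) → m ≤ m' → sumBelow m f ≤ sumBelow m' f
sumBelow-monoˡ-≤ {m} {m'} f m≤m' = begin
  sumBelow m f                                           ≤⟨ m≤m+n _ _ ⟩
  sumBelow m f + sumBelow (m' ∸ m) (λ i → f (m + i))     ≡⟨ sumBelow-+ m (m' ∸ m) f ⟨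
  sumBelow (m + (m' ∸ m)) f                              ≡⟨ cong (λ k → sumBelow k f) (m+[n∸m]≡n m≤m') ⟩
  sumBelow m' f                                          ∎
  where open ≤-Reasoning

m<n∸o⇒o+m<n : ∀ o {m n} → m < n ∸ o → o + m < n
m<n∸o⇒o+m<n zero                m<n   = m<n
m<n∸o⇒o+m<n (suc o) {n = suc n} m<n∸o = s<s (m<n∸o⇒o+m<n o m<n∸o)

sumFromTo-mono-≤ : ∀ a b (f g : ℕ → ℕ) → (∀ {i} → a ≤ i → i ≤ b → f i ≤ g i) →
                   sumFromTo a b f ≤ sumFromTo a b g
sumFromTo-mono-≤ a b f g f≤g =
  sumBelow-mono-≤ (suc b ∸ a) (λ {k} k<len → f≤g (m≤m+n a k) (s≤s⁻¹ (m<n∸o⇒o+m<n a k<len)))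

sumFromTo-mono-< : ∀ a b (f g : ℕ → ℕ) → (∀ {i} → a ≤ i → i ≤ b → f i ≤ g i) →
                   ∀ {j} → a ≤ j → j ≤ b → f j < g j → sumFromTo a b f < sumFromTo a b g
sumFromTo-mono-< a b f g f≤g a≤j j≤b fj<gj =
  sumBelow-mono-< (suc b ∸ a) (λ {k} k<len → f≤g (m≤m+n a k) (s≤s⁻¹ (m<n∸o⇒o+m<n a k<len)))
    (∸-monoˡ-< (s≤s j≤b) a≤j) (subst (λ i → f i < g i) (sym (m+[n∸m]≡n a≤j)) fj<gj)

sumFromTo-term : ∀ a b (f : ℕ → ℕ) {j} → a ≤ j → j ≤ b → f j ≤ sumFromTo a b f
sumFromTo-term a b f a≤j j≤b =
  subst (λ i → f i ≤ sumFromTo a b f) (m+[n∸m]≡n a≤j)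
    (sumBelow-term (suc b ∸ a) (λ i → f (a + i)) (∸-monoˡ-< (s≤s j≤b) a≤j))

sumFromTo-monoʳ-≤ : ∀ a {b b'} (f : ℕ → ℕ) → b ≤ b' → sumFromTo a b f ≤ sumFromTo a b' f
sumFromTo-monoʳ-≤ a f b≤b' = sumBelow-monoˡ-≤ (λ i → f (a + i)) (∸-monoˡ-≤ a (s≤s b≤b'))

sumFromTo-split : ∀ a m b (f : ℕ → ℕ) → a ≤ suc m → m ≤ b →
                  sumFromTo a b f ≡ sumFromTo a m f + sumFromTo (suc m) b f
sumFromTo-split a m b f a≤1+m m≤b = begin
  sumBelow (suc b ∸ a) g                                ≡⟨ cong (λ k → sumBelow k g) length-split ⟩
  sumBelow ((suc m ∸ a) + (b ∸ m)) g                    ≡⟨ sumBelow-+ (suc m ∸ a) (b ∸ m) g ⟩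
  sumFromTo a m f + sumBelow (b ∸ m) (λ i → g ((suc m ∸ a) + i))
    ≡⟨ cong (sumFromTo a m f +_) (sumBelow-cong (b ∸ m) (λ {i} _ → cong f (shift i))) ⟩
  sumFromTo a m f + sumFromTo (suc m) b f               ∎
  where
  open ≡-Reasoning
  g : ℕ → ℕ
  g i = f (a + i)
  length-split : suc b ∸ a ≡ (suc m ∸ a) + (b ∸ m)
  length-split = trans (cong (_∸ a) (sym (m+[n∸m]≡n (s≤s m≤b)))) (+-∸-comm (b ∸ m) a≤1+m)
  shift : ∀ i → a + ((suc m ∸ a) + i) ≡ suc m + i
  shift i = trans (sym (+-assoc a _ i)) (cong (_+ i) (m+[n∸m]≡n a≤1+m))

sumFromTo-split-≤ : ∀ a m b (f : ℕ → ℕ) → a ≤ suc m →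
                    sumFromTo a b f ≤ sumFromTo a m f + sumFromTo (suc m) b f
sumFromTo-split-≤ a m b f a≤1+m with m ≤? b
... | yes m≤b = ≤-reflexive (sumFromTo-split a m b f a≤1+m m≤b)
... | no  m≰b = ≤-trans (sumFromTo-monoʳ-≤ a f (<⇒≤ (≰⇒> m≰b))) (m≤m+n _ _)

private
  ≤-*-self : ∀ {x} c → 1 ≤ c → x ≤ c * x
  ≤-*-self {x} (suc c) _ = m≤m+n x (c * x)

  <-*-self : ∀ {x} c → 1 ≤ x → 2 ≤ c → x < c * x
  <-*-self {x} (suc (suc c)) 1≤x _         = m<m+n x (≤-trans 1≤x (m≤m+n x (c * x)))
  <-*-self     (suc zero)    _   (s≤s ())

module _ (d : ℕ → ℕ) (Δ : ℕ) where

  weight : ℕ → ℕ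
  weight t = 1 + t * sumFromTo (t + 1) Δ d + sumFromTo 2 t (λ i → (i ∸ 1) * d i)

  baseWeight : ℕ
  baseWeight = 1 + sumFromTo 2 Δ d

  private
    d≤[i∸1]*d : ∀ {i} → 2 ≤ i → d i ≤ (i ∸ 1) * d i
    d≤[i∸1]*d 2≤i = ≤-*-self _ (∸-monoˡ-≤ 1 2≤i)

    split-at : ∀ t → 1 ≤ t → sumFromTo 2 Δ d ≤ sumFromTo 2 t d + sumFromTo (t + 1) Δ d
    split-at t 1≤t = subst (λ u → sumFromTo 2 Δ d ≤ sumFromTo 2 t d + sumFromTo u Δ d) (+-comm 1 t)
                           (sumFromTo-split-≤ 2 t Δ d (s≤s 1≤t))

    head≤ : ∀ t → sumFromTo 2 t d ≤ sumFromTo 2 t (λ i → (i ∸ 1) * d i)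
    head≤ t = sumFromTo-mono-≤ 2 t d (λ i → (i ∸ 1) * d i) (λ 2≤i _ → d≤[i∸1]*d 2≤i)

  baseWeight≤weight : ∀ {t} → 1 ≤ t → baseWeight ≤ weight t
  baseWeight≤weight {t} 1≤t = s≤s (begin
    sumFromTo 2 Δ d                                              ≤⟨ split-at t 1≤t ⟩
    sumFromTo 2 t d + sumFromTo (t + 1) Δ d                      ≡⟨ +-comm (sumFromTo 2 t d) _ ⟩
    sumFromTo (t + 1) Δ d + sumFromTo 2 t d                      ≤⟨ +-mono-≤ (≤-*-self t 1≤t) (head≤ t) ⟩
    t * sumFromTo (t + 1) Δ d + sumFromTo 2 t (λ i → (i ∸ 1) * d i) ∎)
    where open ≤-Reasoning

  -- A degree k ≥ 3 is counted once in baseWeight but min(k ∸ 1, t) ≥ 2 times in weight t.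
  baseWeight<weight : ∀ {t k} → 2 ≤ t → 3 ≤ k → k ≤ Δ → 1 ≤ d k → baseWeight < weight t
  baseWeight<weight {t} {k} 2≤t 3≤k k≤Δ 1≤dk = s≤s (begin-strict
    sumFromTo 2 Δ d                                              ≤⟨ split-at t (≤-trans (s≤s z≤n) 2≤t) ⟩
    sumFromTo 2 t d + sumFromTo (t + 1) Δ d                      ≡⟨ +-comm (sumFromTo 2 t d) _ ⟩
    sumFromTo (t + 1) Δ d + sumFromTo 2 t d                      <⟨ gap ⟩
    t * sumFromTo (t + 1) Δ d + sumFromTo 2 t (λ i → (i ∸ 1) * d i) ∎)
    where
    open ≤-Reasoning
    gap : sumFromTo (t + 1) Δ d + sumFromTo 2 t d < t * sumFromTo (t + 1) Δ d + sumFromTo 2 t (λ i → (i ∸ 1) * d i)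
    gap with k ≤? t
    ... | yes k≤t = +-mono-≤-< (≤-*-self t (≤-trans (s≤s z≤n) 2≤t))
                      (sumFromTo-mono-< 2 t d (λ i → (i ∸ 1) * d i) (λ 2≤i _ → d≤[i∸1]*d 2≤i)
                         (≤-trans (s≤s (s≤s z≤n)) 3≤k) k≤t (<-*-self (k ∸ 1) 1≤dk (∸-monoˡ-≤ 1 3≤k)))
    ... | no  k≰t = let t+1≤k = subst (_≤ k) (+-comm 1 t) (≰⇒> k≰t) in
                    +-mono-<-≤
                      (<-*-self t (≤-trans 1≤dk (sumFromTo-term (t + 1) Δ d t+1≤k k≤Δ)) 2≤t)
                      (head≤ t)

weighted-sum-< : (e w : ℕ → ℕ) (w₀ m s : ℕ) →
  (∀ {t} → 1 ≤ t → w₀ ≤ w t) → (∀ {t} → 2 ≤ t → w₀ < w t) → 2 + s ≤ m → 1 ≤ e s →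
  sumBelow m (λ t → e t * w₀) < sumFromTo 1 m (λ t → e (m ∸ t) * w t)
weighted-sum-< e w w₀ m s w₀≤w w₀<w 2+s≤m 1≤es =
  subst (_< sumFromTo 1 m (λ t → e (m ∸ t) * w t)) (sym (sumBelow-reverse m (λ t → e t * w₀)))
    (sumFromTo-mono-< 1 m (λ t → e (m ∸ t) * w₀) (λ t → e (m ∸ t) * w t)
       (λ {t} 1≤t _ → *-monoʳ-≤ (e (m ∸ t)) (w₀≤w 1≤t))
       (m<n⇒0<n∸m s<m) (m∸n≤m m s) strict)
  where
  s<m : s < m
  s<m = ≤-trans (n≤1+n (suc s)) 2+s≤m
  strict : e (m ∸ (m ∸ s)) * w₀ < e (m ∸ (m ∸ s)) * w (m ∸ s)
  strict rewrite m∸[m∸n]≡n (<⇒≤ s<m) =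
    *-monoʳ-< (e s) {{>-nonZero 1≤es}}
      (w₀<w (subst (_≤ m ∸ s) (m+n∸n≡m 2 s) (∸-monoˡ-≤ s 2+s≤m)))

countTrue-tabulate : ∀ {N} (p : Fin N → Bool) → countTrue (map p (allFin N)) ≡ countTrue (tabulate p)
countTrue-tabulate p = cong countTrue (map-tabulate id p)

private
  count-tail : ∀ {N} (p : Fin (suc N) → Bool) → countTrue (tabulate (p ∘ fsuc)) ≤ countTrue (tabulate p)
  count-tail p with p fzero
  ... | true  = n≤1+n _
  ... | false = ≤-refl

  count-head : ∀ {N} (p : Fin (suc N) → Bool) → p fzero ≡ true →
               suc (countTrue (tabulate (p ∘ fsuc))) ≤ countTrue (tabulate p)
  count-head p p₀ with p fzero
  count-head p refl | true = ≤-refl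

countTrue-≥1 : ∀ {N} (p : Fin N → Bool) {a} → p a ≡ true → 1 ≤ countTrue (tabulate p)
countTrue-≥1 p {fzero}  pa = ≤-trans (s≤s z≤n) (count-head p pa)
countTrue-≥1 p {fsuc a} pa = ≤-trans (countTrue-≥1 (p ∘ fsuc) pa) (count-tail p)

countTrue-≥2 : ∀ {N} (p : Fin N → Bool) {a b} → a ≢ b →
               p a ≡ true → p b ≡ true → 2 ≤ countTrue (tabulate p)
countTrue-≥2 p {fzero}  {fzero}  a≢b _  _  = ⊥-elim (a≢b refl)
countTrue-≥2 p {fzero}  {fsuc b} _   pa pb = ≤-trans (s≤s (countTrue-≥1 (p ∘ fsuc) pb)) (count-head p pa)
countTrue-≥2 p {fsuc a} {fzero}  _   pa pb = ≤-trans (s≤s (countTrue-≥1 (p ∘ fsuc) pa)) (count-head p pb)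
countTrue-≥2 p {fsuc a} {fsuc b} a≢b pa pb =
  ≤-trans (countTrue-≥2 (p ∘ fsuc) (a≢b ∘ cong fsuc) pa pb) (count-tail p)

countTrue-≥3 : ∀ {N} (p : Fin N → Bool) {a b c} → a ≢ b → a ≢ c → b ≢ c →
               p a ≡ true → p b ≡ true → p c ≡ true → 3 ≤ countTrue (tabulate p)
countTrue-≥3 p {fzero}  {fzero}  {_}      a≢b _   _   _  _  _  = ⊥-elim (a≢b refl)
countTrue-≥3 p {fzero}  {fsuc _} {fzero}  _   a≢c _   _  _  _  = ⊥-elim (a≢c refl)
countTrue-≥3 p {fsuc _} {fzero}  {fzero}  _   _   b≢c _  _  _  = ⊥-elim (b≢c refl)
countTrue-≥3 p {fzero}  {fsuc b} {fsuc c} _   _   b≢c pa pb pc =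
  ≤-trans (s≤s (countTrue-≥2 (p ∘ fsuc) (b≢c ∘ cong fsuc) pb pc)) (count-head p pa)
countTrue-≥3 p {fsuc a} {fzero}  {fsuc c} _   a≢c _   pa pb pc =
  ≤-trans (s≤s (countTrue-≥2 (p ∘ fsuc) (a≢c ∘ cong fsuc) pa pc)) (count-head p pb)
countTrue-≥3 p {fsuc a} {fsuc b} {fzero}  a≢b _   _   pa pb pc =
  ≤-trans (s≤s (countTrue-≥2 (p ∘ fsuc) (a≢b ∘ cong fsuc) pa pb)) (count-head p pc)
countTrue-≥3 p {fsuc a} {fsuc b} {fsuc c} a≢b a≢c b≢c pa pb pc =
  ≤-trans (countTrue-≥3 (p ∘ fsuc) (a≢b ∘ cong fsuc) (a≢c ∘ cong fsuc) (b≢c ∘ cong fsuc) pa pb pc)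
          (count-tail p)

dcount-deg-pos : ∀ (G : Graph) v → 1 ≤ dcount G (deg G v)
dcount-deg-pos G v =
  ≤-trans (countTrue-≥1 (λ w → ⌊ deg G w ≟ deg G v ⌋) {v} (cong ⌊_⌋ (≟-diag refl)))
          (≤-reflexive (sym (countTrue-tabulate (λ w → ⌊ deg G w ≟ deg G v ⌋))))

private
  ≤-foldr-⊔ : ∀ {A : Set} (f : A → ℕ) {x xs} → x ∈ xs → f x ≤ foldr _⊔_ 0 (map f xs)
  ≤-foldr-⊔ f (Any.here refl)             = m≤m⊔n _ _
  ≤-foldr-⊔ f {xs = y ∷ _} (Any.there x∈xs) = ≤-trans (≤-foldr-⊔ f x∈xs) (m≤n⊔m (f y) _)

deg≤maxDeg : ∀ (G : Graph) v → deg G v ≤ maxDeg G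
deg≤maxDeg G v = ≤-foldr-⊔ (deg G) (∈-allFin v)

pathAdj-sym : ∀ m (i j : Fin m) → pathAdj m i j ≡ pathAdj m j i
pathAdj-sym m i j = ∨-comm ⌊ suc (toℕ i) ≟ toℕ j ⌋ ⌊ suc (toℕ j) ≟ toℕ i ⌋

pathAdj-irrefl : ∀ m (i : Fin m) → pathAdj m i i ≡ false
pathAdj-irrefl m i with suc (toℕ i) ≟ toℕ i
... | yes e = ⊥-elim (1+n≢n e)
... | no  _ = refl

module Paths (T : Graph) where

  private
    V : Set
    V = Fin (n T)

  _~_ : V → V → Set
  x ~ y = adj T x y ≡ true

  ~-sym : ∀ {x y} → x ~ y → y ~ x
  ~-sym {x} {y} x~y = trans (Graph.sym T y x) x~y

  ~-irrefl : ∀ {x} → ¬ x ~ x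
  ~-irrefl {x} x~x = contradiction (trans (sym x~x) (irrefl T x)) λ ()

  -- vertex i is meaningful only for i < len.
  record Path : Set where
    field
      len       : ℕ
      vertex    : ℕ → V
      nonempty  : 1 ≤ len
      adjacent  : ∀ {i} → suc i < len → vertex i ~ vertex (suc i)
      injective : ∀ {i j} → i < len → j < len → vertex i ≡ vertex j → i ≡ j

  open Path public

  first last : Path → V
  first P = vertex P 0
  last  P = vertex P (len P ∸ 1)

  _∈ₚ_ : V → Path → Set
  w ∈ₚ P = ∃ λ i → i < len P × vertex P i ≡ w

  _∈ₚ?_ : ∀ w P → Dec (w ∈ₚ P)
  w ∈ₚ? P = anyUpTo? (λ i → vertex P i ≟ᶠ w) (len P)

  AllNeighboursOn : Path → V → Set
  AllNeighboursOn P x = ∀ {w} → x ~ w → w ∈ₚ P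

  len≤n : ∀ P → len P ≤ n T
  len≤n P = injective⇒≤ (toℕ-injective ∘ injective P (toℕ<n _) (toℕ<n _))

  singleton : V → Path
  singleton v = record
    { len = 1 ; vertex = λ _ → v ; nonempty = ≤-refl
    ; adjacent = λ { (s<s ()) }
    ; injective = λ i<1 j<1 _ → trans (n<1⇒n≡0 i<1) (sym (n<1⇒n≡0 j<1)) }

  prepend : ∀ P {w} → first P ~ w → ¬ w ∈ₚ P → Path
  prepend P {w} P₀~w w∉P = record
    { len = suc (len P) ; vertex = vertex′ ; nonempty = s≤s z≤n
    ; adjacent = adjacent′ ; injective = injective′ }
    where
    vertex′ : ℕ → V
    vertex′ zero    = w
    vertex′ (suc i) = vertex P i
    adjacent′ : ∀ {i} → suc i < suc (len P) → vertex′ i ~ vertex′ (suc i)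
    adjacent′ {zero}  _         = ~-sym P₀~w
    adjacent′ {suc i} (s<s i<l) = adjacent P i<l
    injective′ : ∀ {i j} → i < suc (len P) → j < suc (len P) → vertex′ i ≡ vertex′ j → i ≡ j
    injective′ {zero}  {zero}  _         _         _ = refl
    injective′ {zero}  {suc j} _         (s<s j<l) e = ⊥-elim (w∉P (j , j<l , sym e))
    injective′ {suc i} {zero}  (s<s i<l) _         e = ⊥-elim (w∉P (i , i<l , e))
    injective′ {suc i} {suc j} (s<s i<l) (s<s j<l) e = cong suc (injective P i<l j<l e)

  reverse : Path → Path
  reverse P = record
    { len = len P ; vertex = λ i → vertex P (len P ∸ suc i) ; nonempty = nonempty P
    ; adjacent = adjacent′ ; injective = injective′ }
    where
    adjacent′ : ∀ {i} → suc i < len P → vertex P (len P ∸ suc i) ~ vertex P (len P ∸ suc (suc i))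
    adjacent′ {i} 2+i≤l = ~-sym (subst (λ j → vertex P (len P ∸ suc (suc i)) ~ vertex P j) reflected
                                       (adjacent P (subst (_< len P) (sym reflected) (∸-monoʳ-< z<s (<⇒≤ 2+i≤l)))))
      where reflected : suc (len P ∸ suc (suc i)) ≡ len P ∸ suc i
            reflected = sym (+-∸-assoc 1 2+i≤l)
    injective′ : ∀ {i j} → i < len P → j < len P → vertex P (len P ∸ suc i) ≡ vertex P (len P ∸ suc j) → i ≡ j
    injective′ i<l j<l e = suc-injective (begin
      suc _                       ≡⟨ m∸[m∸n]≡n i<l ⟨
      len P ∸ (len P ∸ suc _)     ≡⟨ cong (len P ∸_) (injective P (∸-monoʳ-< z<s i<l) (∸-monoʳ-< z<s j<l) e) ⟩
      len P ∸ (len P ∸ suc _)     ≡⟨ m∸[m∸n]≡n j<l ⟩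
      suc _                       ∎)
      where open ≡-Reasoning

  ∈-reverse : ∀ {P w} → w ∈ₚ P → w ∈ₚ reverse P
  ∈-reverse {P} (j , j<l , vⱼ≡w) =
    len P ∸ suc j , ∸-monoʳ-< z<s j<l ,
    trans (cong (vertex P) (trans (cong (len P ∸_) (sym (+-∸-assoc 1 j<l))) (m∸[m∸n]≡n (<⇒≤ j<l)))) vⱼ≡w

  last-reverse : ∀ P → last (reverse P) ≡ first P
  last-reverse P = cong (vertex P) (trans (cong (len P ∸_) (m+[n∸m]≡n (nonempty P))) (n∸n≡0 (len P)))

  -- The fuel k bounds the number of prepended vertices, since a path has at most n T vertices.
  maximal-prepend : ∀ k P → n T ≤ k + len P →
    Σ Path λ Q → AllNeighboursOn Q (first Q) × (∀ {u} → u ∈ₚ P → u ∈ₚ Q) × last Q ≡ last P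
  maximal-prepend k P n≤k+l with any? (λ w → (adj T (first P) w ≟ᵇ true) ×-dec ¬? (w ∈ₚ? P))
  ... | no stuck = P , closed , id , refl
    where
    closed : AllNeighboursOn P (first P)
    closed {w} P₀~w with w ∈ₚ? P
    ... | yes w∈P = w∈P
    ... | no  w∉P = ⊥-elim (stuck (w , P₀~w , w∉P))
  maximal-prepend zero    P n≤l     | yes (w , P₀~w , w∉P) =
    ⊥-elim (1+n≰n (≤-trans (len≤n (prepend P P₀~w w∉P)) n≤l))
  maximal-prepend (suc k) P n≤k+1+l | yes (w , P₀~w , w∉P)
    with maximal-prepend k (prepend P P₀~w w∉P) (≤-trans n≤k+1+l (≤-reflexive (sym (+-suc k (len P)))))
  ... | Q , Q-closed , P′⊆Q , lastQ≡ =
    Q , Q-closed , (λ { (i , i<l , e) → P′⊆Q (suc i , s<s i<l , e) }) ,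
    trans lastQ≡ (cong (vertex (prepend P P₀~w w∉P)) (sym (m+[n∸m]≡n (nonempty P))))

  closedPath : V → Σ Path λ P → AllNeighboursOn P (first P) × AllNeighboursOn P (last P)
  closedPath v with maximal-prepend (n T) (singleton v) (m≤m+n (n T) 1)
  ... | P , P-closed , _ , _ with maximal-prepend (n T) (reverse P) (m≤m+n (n T) (len P))
  ... | Q , Q-closed , P⊆Q , lastQ≡ = Q , Q-closed , last-closed
    where
    last-closed : AllNeighboursOn Q (last Q)
    last-closed {w} Qₗ~w = P⊆Q (∈-reverse {P} (P-closed (subst (λ x → x ~ w) (trans lastQ≡ (last-reverse P)) Qₗ~w)))

  closing-edge⇒cycle : ∀ P {k} → 3 + k ≤ len P → vertex P (2 + k) ~ first P → HasCycle T
  closing-edge⇒cycle P {k} 3+k≤l closing =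
    k , vertex P ∘ toℕ , toℕ-injective ∘ injective P (below (toℕ<n _)) (below (toℕ<n _)) ,
    (λ i → subst (λ j → vertex P j ~ vertex P (suc (toℕ i))) (sym (toℕ-inject₁ i))
                 (adjacent P (below (s<s (toℕ<n i))))) ,
    subst (λ j → vertex P j ~ first P) (sym (toℕ-fromℕ (2 + k))) closing
    where
    below : ∀ {i} → i < 3 + k → i < len P
    below i<3+k = ≤-trans i<3+k 3+k≤l

  module ClosedPath (acyclic : ¬ HasCycle T) (deg≤2 : ∀ v → deg T v ≤ 2)
                    (P : Path) (first-closed : AllNeighboursOn P (first P))
                    (last-closed : AllNeighboursOn P (last P)) where

    private
      l : ℕ
      l = len P
      v : ℕ → V
      v = vertex P

    no-third-neighbour : ∀ {x a b c} → a ≢ b → a ≢ c → b ≢ c → x ~ a → x ~ b → x ~ c → ⊥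
    no-third-neighbour {x} a≢b a≢c b≢c x~a x~b x~c = 1+n≰n (begin
      3                                  ≤⟨ countTrue-≥3 (adj T x) a≢b a≢c b≢c x~a x~b x~c ⟩
      countTrue (tabulate (adj T x))     ≡⟨ countTrue-tabulate (adj T x) ⟨
      deg T x                            ≤⟨ deg≤2 x ⟩
      2                                  ∎)
      where open ≤-Reasoning

    inner-neighbours : ∀ {i w} → suc (suc i) < l → v (suc i) ~ w → w ≡ v i ⊎ w ≡ v (suc (suc i))
    inner-neighbours {i} {w} 3+i≤l vᵢ₊₁~w with w ≟ᶠ v i | w ≟ᶠ v (suc (suc i))
    ... | yes w≡vᵢ | _          = inj₁ w≡vᵢ
    ... | no  _    | yes w≡vᵢ₊₂ = inj₂ w≡vᵢ₊₂
    ... | no  w≢vᵢ | no  w≢vᵢ₊₂ = ⊥-elim (no-third-neighbour vᵢ≢vᵢ₊₂ (w≢vᵢ ∘ sym) (w≢vᵢ₊₂ ∘ sym)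
                                    (~-sym (adjacent P (<⇒≤ 3+i≤l))) (adjacent P 3+i≤l) vᵢ₊₁~w)
      where
      vᵢ≢vᵢ₊₂ : v i ≢ v (suc (suc i))
      vᵢ≢vᵢ₊₂ e = <-irrefl (injective P (<⇒≤ (<⇒≤ 3+i≤l)) 3+i≤l e) (m<n⇒m<1+n ≤-refl)

    neighbours-on-path : ∀ {i} → i < l → AllNeighboursOn P (v i)
    neighbours-on-path {zero}  _       = first-closed
    neighbours-on-path {suc i} 2+i≤l {w} vᵢ₊₁~w with suc (suc i) ≟ l
    ... | yes 2+i≡l = last-closed (subst (λ j → v j ~ w) (cong (_∸ 1) 2+i≡l) vᵢ₊₁~w)
    ... | no  2+i≢l with inner-neighbours (≤∧≢⇒< 2+i≤l 2+i≢l) vᵢ₊₁~w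
    ...   | inj₁ w≡vᵢ   = i , ≤-trans (n≤1+n _) 2+i≤l , sym w≡vᵢ
    ...   | inj₂ w≡vᵢ₊₂ = suc (suc i) , ≤∧≢⇒< 2+i≤l 2+i≢l , sym w≡vᵢ₊₂

    ∈ₚ-walk : ∀ {x y} → Walk T x y → x ∈ₚ P → y ∈ₚ P
    ∈ₚ-walk here              x∈P                 = x∈P
    ∈ₚ-walk (step x~w w⇝y) (i , i<l , refl) = ∈ₚ-walk w⇝y (neighbours-on-path i<l x~w)

    private
      data Position (i : ℕ) : Set where
        start : i ≡ 0 → Position i
        inner : ∀ {i′} → i ≡ suc i′ → suc (suc i′) < l → Position i
        end   : suc i ≡ l → Position i

      position : ∀ {i} → i < l → Position i
      position {zero}  _ = start refl
      position {suc i} 2+i≤l with suc (suc i) ≟ l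
      ... | yes 2+i≡l = end 2+i≡l
      ... | no  2+i≢l = inner refl (≤∧≢⇒< 2+i≤l 2+i≢l)

      closing-neighbour : ∀ {j} → suc j ≡ l → v j ~ v 0 → 1 ≡ j
      closing-neighbour {zero}        _     loop    = ⊥-elim (~-irrefl loop)
      closing-neighbour {suc zero}    _     _       = refl
      closing-neighbour {suc (suc j)} 3+j≡l closing =
        ⊥-elim (acyclic (closing-edge⇒cycle P (≤-reflexive 3+j≡l) closing))

      inner-consecutive : ∀ {i j} → suc (suc i) < l → j < l → v (suc i) ~ v j → suc (suc i) ≡ j ⊎ suc j ≡ suc i
      inner-consecutive {i} 3+i≤l j<l vᵢ₊₁~vⱼ with inner-neighbours 3+i≤l vᵢ₊₁~vⱼ
      ... | inj₁ vⱼ≡vᵢ   = inj₂ (cong suc (injective P j<l (<⇒≤ (<⇒≤ 3+i≤l)) vⱼ≡vᵢ))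
      ... | inj₂ vⱼ≡vᵢ₊₂ = inj₁ (sym (injective P j<l 3+i≤l vⱼ≡vᵢ₊₂))

    adjacent⇒consecutive : ∀ {i j} → i < l → j < l → v i ~ v j → suc i ≡ j ⊎ suc j ≡ i
    adjacent⇒consecutive {i} {j} i<l j<l vᵢ~vⱼ with position i<l | position j<l
    ... | inner refl 3+i≤l | _                = inner-consecutive 3+i≤l j<l vᵢ~vⱼ
    ... | _                | inner refl 3+j≤l = swap (inner-consecutive 3+j≤l i<l (~-sym vᵢ~vⱼ))
    ... | start refl       | start refl       = ⊥-elim (~-irrefl vᵢ~vⱼ)
    ... | start refl       | end 1+j≡l        = inj₁ (closing-neighbour 1+j≡l (~-sym vᵢ~vⱼ))
    ... | end 1+i≡l        | start refl       = inj₂ (closing-neighbour 1+i≡l vᵢ~vⱼ)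
    ... | end 1+i≡l        | end 1+j≡l        =
      ⊥-elim (~-irrefl (subst (λ k → v i ~ v k) (suc-injective (trans 1+j≡l (sym 1+i≡l))) vᵢ~vⱼ))

    adj-on-path : ∀ {i j} → i < l → j < l → adj T (v i) (v j) ≡ (⌊ suc i ≟ j ⌋ ∨ ⌊ suc j ≟ i ⌋)
    adj-on-path {i} {j} i<l j<l with suc i ≟ j | suc j ≟ i
    ... | yes refl | _        = adjacent P j<l
    ... | no _     | yes refl = ~-sym (adjacent P i<l)
    ... | no 1+i≢j | no 1+j≢i with adj T (v i) (v j) in vᵢ~vⱼ
    ...   | false = refl
    ...   | true with adjacent⇒consecutive i<l j<l vᵢ~vⱼ
    ...     | inj₁ 1+i≡j = ⊥-elim (1+i≢j 1+i≡j)
    ...     | inj₂ 1+j≡i = ⊥-elim (1+j≢i 1+j≡i)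

    module _ (connected : Connected T) where

      private
        spanning : ∀ u → u ∈ₚ P
        spanning u = ∈ₚ-walk (connected (first P) u) (0 , nonempty P , refl)

        index : V → ℕ
        index u = proj₁ (spanning u)

        index<l : ∀ u → index u < l
        index<l u = proj₁ (proj₂ (spanning u))

        vertex-index : ∀ u → v (index u) ≡ u
        vertex-index u = proj₂ (proj₂ (spanning u))

        index-injective : ∀ {x y} → index x ≡ index y → x ≡ y
        index-injective {x} {y} e = trans (sym (vertex-index x)) (trans (cong v e) (vertex-index y))

        l≡n : l ≡ n T
        l≡n = ≤-antisym (len≤n P)
          (injective⇒≤ (index-injective ∘ fromℕ<-injective _ _ (index<l _) (index<l _)))

        toPath : V → Fin (n T)
        toPath u = fromℕ< (subst (index u <_) l≡n (index<l u))

        toℕ-toPath : ∀ u → toℕ (toPath u) ≡ index u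
        toℕ-toPath u = toℕ-fromℕ< (subst (index u <_) l≡n (index<l u))

        toPath-injective : ∀ {x y} → toPath x ≡ toPath y → x ≡ y
        toPath-injective {x} {y} e = index-injective (trans (sym (toℕ-toPath x)) (trans (cong toℕ e) (toℕ-toPath y)))

        toPath-surjective : ∀ k → ∃ λ u → ∀ {z} → z ≡ u → toPath z ≡ k
        toPath-surjective k = v (toℕ k) , λ { refl → toℕ-injective (trans (toℕ-toPath _)
          (injective P (index<l _) (subst (toℕ k <_) (sym l≡n) (toℕ<n k)) (vertex-index (v (toℕ k))))) }

        toPath-adj : ∀ x y → adj T x y ≡ pathAdj (n T) (toPath x) (toPath y)
        toPath-adj x y = begin
          adj T x y                                            ≡⟨ cong₂ (adj T) (vertex-index x) (vertex-index y) ⟨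
          adj T (v (index x)) (v (index y))                    ≡⟨ adj-on-path (index<l x) (index<l y) ⟩
          ⌊ suc (index x) ≟ index y ⌋ ∨ ⌊ suc (index y) ≟ index x ⌋
            ≡⟨ cong₂ (λ a b → ⌊ suc a ≟ b ⌋ ∨ ⌊ suc b ≟ a ⌋) (toℕ-toPath x) (toℕ-toPath y) ⟨
          pathAdj (n T) (toPath x) (toPath y)                  ∎
          where open ≡-Reasoning

      isPath : IsPath T
      isPath = pathAdj-sym (n T) , pathAdj-irrefl (n T) , toPath , (toPath-injective , toPath-surjective) , toPath-adj

tree-maxDeg≤2⇒path : ∀ T → IsTree T → Fin (n T) → (∀ v → deg T v ≤ 2) → IsPath T
tree-maxDeg≤2⇒path T (connected , acyclic) v deg≤2 with Paths.closedPath T v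
... | P , first-closed , last-closed = Paths.ClosedPath.isPath T acyclic deg≤2 P first-closed last-closed connected

degree-sums-< : ∀ (T G : Graph) r {u v} → 3 ≤ deg T u → 2 + deg G v ≤ r →
  sumBelow r (λ t → dcount G t * baseWeight (dcount T) (maxDeg T))
    < sumFromTo 1 r (λ t → dcount G (r ∸ t) * weight (dcount T) (maxDeg T) t)
degree-sums-< T G r {u} {v} 3≤deg-u 2+deg-v≤r =
  weighted-sum-< (dcount G) (weight (dcount T) (maxDeg T)) (baseWeight (dcount T) (maxDeg T)) r (deg G v)
    (baseWeight≤weight (dcount T) (maxDeg T))
    (λ 2≤t → baseWeight<weight (dcount T) (maxDeg T) 2≤t 3≤deg-u (deg≤maxDeg T u) (dcount-deg-pos T u))
    2+deg-v≤r (dcount-deg-pos G v)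

proposition3p4 :
    (K : Field) (T : Graph) → IsTree T → 2 ≤ n T →
    (r : ℕ) → 1 ≤ r →
    (G : Graph) (c : Fin (n G) → Fin (n G) → Field.Carrier K) → IsProperColouring K G c →
    (mr mr₁ wr wr₁ : ℕ) →
    IsMe G r mr → IsMe G (r ∸ 1) mr₁ →
    IsDimW K G r c wr → IsDimW K G (r ∸ 1) c wr₁ →
    mr ≡ wr → mr₁ ≡ wr₁ →
    mr + (n T ∸ 1) * mr₁ + dcount G (r ∸ 1)
      + sumFromTo 1 (r ∸ 1) (λ t → dcount G (r ∸ 1 ∸ t)
          * (1 + t * sumFromTo (t + 1) (maxDeg T) (dcount T)
               + sumFromTo 2 t (λ i → (i ∸ 1) * dcount T i)))
    ≡ wr + (n T ∸ 1) * wr₁ + dcount G (r ∸ 1)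
      + sumBelow (r ∸ 1) (λ t → dcount G t * (1 + sumFromTo 2 (maxDeg T) (dcount T))) →
    MinDegAtLeast G (r ∸ 2) ⊎ IsPath T
proposition3p4 K T tree 2≤n zero () G c _ mr mr₁ wr wr₁ _ _ _ _ _ _ _
proposition3p4 K T tree 2≤n (suc r) _ G c _ mr mr₁ .mr .mr₁ _ _ _ _ refl refl sums≡
  with all? (λ v → r ∸ 1 ≤? deg G v)
... | yes δ≥r-1 = inj₁ δ≥r-1
... | no  δ≱r-1 with any? (λ u → 3 ≤? deg T u)
...   | no  no-deg-3 =
  inj₂ (tree-maxDeg≤2⇒path T tree (fromℕ< (≤-trans (s≤s z≤n) 2≤n))
                            (λ u → ≤-pred (≰⇒> (no-deg-3 ∘ (u ,_)))))
...   | yes (u , 3≤deg-u) with ¬∀⟶∃¬ (n G) _ (λ v → r ∸ 1 ≤? deg G v) δ≱r-1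
...     | v , deg-v≱r-1 =
  ⊥-elim (<-irrefl (sym (+-cancelˡ-≡ _ _ _ sums≡))
                   (degree-sums-< T G r 3≤deg-u (m<n∸o⇒o+m<n 1 (≰⇒> deg-v≱r-1))))
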